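{- Let $\alpha$ be an irrational real number, $N\ge1$, and $S_\alpha(N)=\{\{n\alpha\}:1\le n\le N\}\subset\mathbb{R}/\mathbb{Z}$. Suppose $L_1,\dots,L_t,R_1,\dots,R_k\in\{1,\dots,N\}$ are such that $L_1\alpha,\dots,L_t\alpha,\alpha,R_1\alpha,\dots,R_k\alpha$ (taken in $\mathbb{R}/\mathbb{Z}$) are consecutive elements of $S_\alpha(N)$ around $\{\alpha\}$, in this order. Then $(N+1-R_k)\alpha,\dots,(N+1-R_1)\alpha,N\alpha,(N+1-L_t)\alpha,\dots,(N+1-L_1)\alpha$ (in $\mathbb{R}/\mathbb{Z}$) are consecutive elements of $S_\alpha(N)$ around $\{N\alpha\}$, in this order.
   Context: $\{x\}$ is the fractional part; $\mathbb{R}/\mathbb{Z}$ is identified with $[0,1)$. "Consecutive elements" of $S_\alpha(N)$ means consecutive with respect to the cyclic order of the points on $\mathbb{R}/\mathbb{Z}$. -}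

module Defs where

open import Level using (0ℓ)
open import Data.Nat as ℕ using (ℕ; zero; suc)
open import Data.Integer as ℤ using (ℤ; +_; -[1+_]; +[1+_])
open import Data.Rational as ℚ using (ℚ)
open import Data.Product using (Σ; ∃; _×_; _,_)
open import Data.Sum using (_⊎_)
open import Data.Unit using (⊤)
open import Data.List using (List; []; _∷_)
open import Data.List.Relation.Unary.All using (All)
open import Data.List.Relation.Unary.Unique.Propositional using (Unique)
open import Relation.Nullary using (¬_)

-- A real number, encoded as a two-sided Dedekind cut on ℚ:
-- L q  means  q < x,   U q  means  x < q.
record ℝ : Set₁ where
  field
    L U        : ℚ → Set
    L-inhabited : ∃ λ q → L q
    U-inhabited : ∃ λ q → U q
    L-rounded  : ∀ q → (L q → ∃ λ r → q ℚ.< r × L r) × ((∃ λ r → q ℚ.< r × L r) → L q)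
    U-rounded  : ∀ q → (U q → ∃ λ r → r ℚ.< q × U r) × ((∃ λ r → r ℚ.< q × U r) → U q)
    disjoint   : ∀ q → ¬ (L q × U q)
    located    : ∀ q r → q ℚ.< r → L q ⊎ U r

open ℝ public

Irrational : ℝ → Set
Irrational x = ∀ q → L x q ⊎ U x q

-- Pos α a b  :  the real number a + b·α is > 0   (a b : ℤ)
Pos : ℝ → ℤ → ℤ → Set
Pos α a (+ zero)    = + 0 ℤ.< a
Pos α a +[1+ k ]    = L α ((ℤ.- a) ℚ./ suc k)
Pos α a (-[1+ k ])  = U α (a ℚ./ suc k)

-- IsFloor α n p  :  p < nα < p + 1, i.e. p = ⌊nα⌋ (nα is not an integer for n ≥ 1)
IsFloor : ℝ → ℕ → ℤ → Set
IsFloor α n p = Pos α (ℤ.- p) (+ n) × Pos α (p ℤ.+ + 1) (ℤ.- (+ n))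

-- FracLt α n m  :  {nα} < {mα}  (as real numbers in [0,1))
FracLt : ℝ → ℕ → ℕ → Set
FracLt α n m = Σ ℤ λ p → Σ ℤ λ q →
  IsFloor α n p × IsFloor α m q × Pos α (p ℤ.- q) (+ m ℤ.- + n)

-- Strict cyclic order on ℝ/ℤ ≅ [0,1): {yα} lies on the open arc going
-- in the positive direction from {xα} to {zα}.
CycBetween : ℝ → ℕ → ℕ → ℕ → Set
CycBetween α x y z =
  (FracLt α x y × FracLt α y z) ⊎ (FracLt α y z × FracLt α z x) ⊎ (FracLt α z x × FracLt α x y)

AdjacentChain : ℝ → ℕ → List ℕ → Set
AdjacentChain α N []            = ⊤
AdjacentChain α N (x ∷ [])      = ⊤
AdjacentChain α N (x ∷ y ∷ ys)  =
  (∀ c → 1 ℕ.≤ c → c ℕ.≤ N → ¬ CycBetween α x c y) × AdjacentChain α N (y ∷ ys)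

Consecutive : ℝ → ℕ → List ℕ → Set
Consecutive α N ns =
  All (λ n → 1 ℕ.≤ n × n ℕ.≤ N) ns × Unique ns × AdjacentChain α N ns

-- Since (N+1-n)α ≡ (N+1)α - nα mod 1, the map n ↦ N+1-n acts on S_α(N) as the reflection
-- t ↦ {(N+1)α} - t of the circle. A reflection reverses the cyclic order, so it carries a run of
-- consecutive points to a run of consecutive points traversed backwards; and it sends α to Nα.
-- Every comparison between the points is a sign condition a + bα > 0 with a, b integers, and
-- such conditions are closed under addition because α is apart from every rational.

module Submission where

open import Defs
open import Data.Nat using (ℕ; _≤_; _∸_; _+_)
open import Data.List using (List; _∷_; []; _++_; map; reverse)

open import Data.Nat as ℕ using (zero; suc; z≤n; s≤s)
import Data.Nat.Properties as ℕP
open import Data.Integer as ℤ using (ℤ; +_; -[1+_]; +[1+_]; +≤+; +<+; -≤+; -≤-)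
import Data.Integer.Properties as ℤP
open import Data.Integer.Tactic.RingSolver using (solve-∀)
open import Data.Rational as ℚ using (ℚ; ↥_; ↧_)
import Data.Rational.Properties as ℚP
import Data.Rational.Unnormalised as ℚᵘ
import Data.Rational.Unnormalised.Properties as ℚᵘP
open import Data.List using (reverseAcc)
import Data.List.Properties as List
open import Data.List.Relation.Unary.All as All using (All; []; _∷_)
import Data.List.Relation.Unary.All.Properties as All
open import Data.List.Relation.Unary.Linked as Linked using (Linked; []; [-]; _∷_)
import Data.List.Relation.Unary.Linked.Properties as Linked
open import Data.List.Relation.Unary.Unique.Propositional using (Unique)
import Data.List.Relation.Unary.Unique.Propositional.Properties as Unique
open import Data.List.Relation.Binary.Permutation.Propositional using (↭-sym; ↭⇒↭ₛ)
open import Data.List.Relation.Binary.Permutation.Propositional.Properties using (↭-reverse; All-resp-↭)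
import Data.List.Relation.Binary.Permutation.Setoid.Properties as Permutationₛ
open import Data.Product using (Σ; _×_; _,_; proj₁; proj₂)
open import Data.Sum using (_⊎_; inj₁; inj₂)
open import Data.Empty using (⊥-elim)
open import Data.Unit using (tt)
open import Function using (_∘_; flip)
open import Relation.Binary using (Rel)
open import Relation.Nullary using (¬_; yes; no)
open import Relation.Unary using (Pred)
open import Relation.Binary.PropositionalEquality
open import Relation.Binary.PropositionalEquality.Properties using (setoid)
open import Relation.Binary.Definitions using (tri<; tri≈; tri>)

/<⇒*< : ∀ i k r → i ℚ./ suc k ℚ.< r → i ℤ.* ↧ r ℤ.< ↥ r ℤ.* + suc k
/<⇒*< i k r@(ℚ.mkℚ _ _ _) lt
  with ℚᵘP.<-respˡ-≃ (ℚP.toℚᵘ-fromℚᵘ (ℚᵘ.mkℚᵘ i k)) (ℚP.toℚᵘ-mono-< lt)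
... | ℚᵘ.*<* h = h

</⇒*< : ∀ i k r → r ℚ.< i ℚ./ suc k → ↥ r ℤ.* + suc k ℤ.< i ℤ.* ↧ r
</⇒*< i k r@(ℚ.mkℚ _ _ _) lt
  with ℚᵘP.<-respʳ-≃ (ℚP.toℚᵘ-fromℚᵘ (ℚᵘ.mkℚᵘ i k)) (ℚP.toℚᵘ-mono-< lt)
... | ℚᵘ.*<* h = h

i<j⇒0<j-i : ∀ {i j} → i ℤ.< j → + 0 ℤ.< j ℤ.- i
i<j⇒0<j-i {i} {j} i<j = subst (ℤ._< j ℤ.- i) (ℤP.+-inverseʳ i) (ℤP.+-monoˡ-< (ℤ.- i) i<j)

0<-i⇒i≤0 : ∀ {i} → + 0 ℤ.< ℤ.- i → i ℤ.≤ + 0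
0<-i⇒i≤0 {i} 0<-i = ℤP.<⇒≤ (ℤP.neg-cancel-< {+ 0} {i} 0<-i)

0<i+1⇒0≤i : ∀ {i} → + 0 ℤ.< i ℤ.+ + 1 → + 0 ℤ.≤ i
0<i+1⇒0≤i {+ n}             _        = +≤+ z≤n
0<i+1⇒0≤i { -[1+ zero ]}    (+<+ ())
0<i+1⇒0≤i { -[1+ suc n ]}   ()

-∣i∣*n≤i : ∀ i n → ℤ.- (+ ℤ.∣ i ∣) ℤ.* + suc n ℤ.≤ i ℤ.* + 1
-∣i∣*n≤i (+ zero)   n = +≤+ z≤n
-∣i∣*n≤i +[1+ m ]   n = -≤+
-∣i∣*n≤i -[1+ m ]   n = subst (-[1+ m ] ℤ.* + suc n ℤ.≤_) (sym (ℤP.*-identityʳ -[1+ m ]))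
  (-≤- (ℕP.≤-trans (ℕP.m≤m*n m (suc n)) (ℕP.m≤n+m (m ℕ.* suc n) n)))

i≤∣i∣*n : ∀ i n → i ℤ.* + 1 ℤ.≤ + ℤ.∣ i ∣ ℤ.* + suc n
i≤∣i∣*n (+ m)      n = ℤP.*-monoˡ-≤-nonNeg (+ m) (+≤+ (s≤s z≤n))
i≤∣i∣*n -[1+ m ]   n = -≤+

squeeze : ∀ {i j k} → k ℤ.≤ j → j ℤ.≤ i → i ℤ.≤ ℤ.suc k →
          (i ≡ j × j ≡ k) ⊎ (i ≡ ℤ.suc k × (i ≡ j ⊎ j ≡ k))
squeeze {i} {j} {k} k≤j j≤i i≤1+k with i ℤ.≟ j | j ℤ.≟ k
... | yes i≡j | yes j≡k = inj₁ (i≡j , j≡k)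
... | yes i≡j | no  j≢k =
  inj₂ (ℤP.≤-antisym i≤1+k (subst (ℤ.suc k ℤ.≤_) (sym i≡j) (ℤP.i<j⇒suc[i]≤j (ℤP.≤∧≢⇒< k≤j (j≢k ∘ sym))))
       , inj₁ i≡j)
... | no  i≢j | _       = inj₂ (ℤP.≤-antisym i≤1+k (subst (ℤ._≤ i) (cong ℤ.suc j≡k) 1+j≤i) , inj₂ j≡k)
  where
  j<i : j ℤ.< i
  j<i = ℤP.≤∧≢⇒< j≤i (i≢j ∘ sym)
  1+j≤i : ℤ.suc j ℤ.≤ i
  1+j≤i = ℤP.i<j⇒suc[i]≤j j<i
  j≡k : j ≡ k
  j≡k = ℤP.≤-antisym (subst (j ℤ.≤_) (ℤP.pred-suc k) (ℤP.i<j⇒i≤pred[j] (ℤP.<-≤-trans j<i i≤1+k))) k≤j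

cycBetween-rotate : ∀ α x y z → CycBetween α x y z → CycBetween α y z x
cycBetween-rotate α x y z (inj₁ xy-yz)         = inj₂ (inj₂ xy-yz)
cycBetween-rotate α x y z (inj₂ (inj₁ yz-zx))  = inj₁ yz-zx
cycBetween-rotate α x y z (inj₂ (inj₂ zx-xy))  = inj₂ (inj₁ zx-xy)

module _ {a ℓ} {A : Set a} {R : Rel A ℓ} where

  Linked-reverseAcc : ∀ {x xs acc} → Linked R (x ∷ xs) → Linked (flip R) (x ∷ acc) →
                      Linked (flip R) (reverseAcc (x ∷ acc) xs)
  Linked-reverseAcc {xs = []}    _             racc = racc
  Linked-reverseAcc {xs = _ ∷ _} (Rxy ∷ Rxs)   racc = Linked-reverseAcc Rxs (Rxy ∷ racc)

  Linked-reverse : ∀ {xs} → Linked R xs → Linked (flip R) (reverse xs)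
  Linked-reverse {[]}    []  = []
  Linked-reverse {_ ∷ _} Rxs = Linked-reverseAcc Rxs [-]

module _ {a p ℓ₁ ℓ₂} {A : Set a} {P : Pred A p} {R : Rel A ℓ₁} {S : Rel A ℓ₂} where

  Linked-map-local : (∀ {x y} → P x → P y → R x y → S x y) → ∀ {xs} → All P xs → Linked R xs → Linked S xs
  Linked-map-local R⇒S []             []          = []
  Linked-map-local R⇒S (_ ∷ [])       [-]         = [-]
  Linked-map-local R⇒S (px ∷ py ∷ ps) (Rxy ∷ Rxs) = R⇒S px py Rxy ∷ Linked-map-local R⇒S (py ∷ ps) Rxs

Unique-reverse : ∀ {a} {A : Set a} {xs : List A} → Unique xs → Unique (reverse xs)
Unique-reverse {xs = xs} = Permutationₛ.Unique-resp-↭ (setoid _) (↭⇒↭ₛ (↭-sym (↭-reverse xs)))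

map-reverse-++-∷ : ∀ {a b} {A : Set a} {B : Set b} (f : A → B) xs x ys →
                   map f (reverse (xs ++ x ∷ ys)) ≡ map f (reverse ys) ++ f x ∷ map f (reverse xs)
map-reverse-++-∷ f xs x ys = begin
  map f (reverse (xs ++ x ∷ ys))
    ≡⟨ cong (map f) (List.reverse-++ xs (x ∷ ys)) ⟩
  map f (reverse (x ∷ ys) ++ reverse xs)
    ≡⟨ cong (λ zs → map f (zs ++ reverse xs)) (List.unfold-reverse x ys) ⟩
  map f ((reverse ys ++ x ∷ []) ++ reverse xs)
    ≡⟨ cong (map f) (List.++-assoc (reverse ys) (x ∷ []) (reverse xs)) ⟩
  map f (reverse ys ++ x ∷ reverse xs)
    ≡⟨ List.map-++ f (reverse ys) (x ∷ reverse xs) ⟩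
  map f (reverse ys) ++ f x ∷ map f (reverse xs)
    ∎
  where open ≡-Reasoning

module LinearForms (α : ℝ) (irrational : Irrational α) where

  L<U : ∀ {q r} → L α q → U α r → q ℚ.< r
  L<U {q} {r} Lq Ur with ℚP.<-cmp q r
  ... | tri< q<r _ _ = q<r
  ... | tri≈ _ refl _ = ⊥-elim (disjoint α q (Lq , Ur))
  ... | tri> _ _ r<q = ⊥-elim (disjoint α q (Lq , proj₂ (U-rounded α q) (r , r<q , Ur)))

  -- ↧ q · (a + b q)
  value : ℤ → ℤ → ℚ → ℤ
  value a b q = a ℤ.* ↧ q ℤ.+ b ℤ.* ↥ q

  Eventually : Pred ℚ _ → Set
  Eventually P = Σ ℚ λ l → L α l × (∀ q → L α q → l ℚ.≤ q → P q)

  eventually-× : ∀ {P Q : Pred ℚ _} → Eventually P → Eventually Q → Eventually (λ q → P q × Q q)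
  eventually-× (l₁ , Ll₁ , P↑) (l₂ , Ll₂ , Q↑) with ℚP.≤-total l₁ l₂
  ... | inj₁ l₁≤l₂ = l₂ , Ll₂ , λ q Lq l₂≤q → P↑ q Lq (ℚP.≤-trans l₁≤l₂ l₂≤q) , Q↑ q Lq l₂≤q
  ... | inj₂ l₂≤l₁ = l₁ , Ll₁ , λ q Lq l₁≤q → P↑ q Lq l₁≤q , Q↑ q Lq (ℚP.≤-trans l₂≤l₁ l₁≤q)

  eventually-witness : ∀ {P : Pred ℚ _} → Eventually P → Σ ℚ P
  eventually-witness (l , Ll , P↑) = l , P↑ l Ll ℚP.≤-refl

  eventually-map : ∀ {P Q : Pred ℚ _} → (∀ q → P q → Q q) → Eventually P → Eventually Q
  eventually-map P⇒Q (l , Ll , P↑) = l , Ll , λ q Lq l≤q → P⇒Q q (P↑ q Lq l≤q)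

  always⇒eventually : ∀ {P : Pred ℚ _} → (∀ q → P q) → Eventually P
  always⇒eventually P! with L-inhabited α
  ... | l , Ll = l , Ll , λ q _ _ → P! q

  value-zero : ∀ a q → value a (+ 0) q ≡ a ℤ.* ↧ q
  value-zero a q = drop-zero a (↧ q) (↥ q)
    where
    drop-zero : ∀ a d n → a ℤ.* d ℤ.+ + 0 ℤ.* n ≡ a ℤ.* d
    drop-zero = solve-∀

  pos⇒eventually-value-pos : ∀ a b → Pos α a b → Eventually (λ q → + 0 ℤ.< value a b q)
  pos⇒eventually-value-pos a (+ zero) 0<a = always⇒eventually λ q →
    subst (+ 0 ℤ.<_) (sym (value-zero a q)) (ℤP.*-monoʳ-<-pos (↧ q) 0<a)
  pos⇒eventually-value-pos a +[1+ k ] α>-a/b with proj₁ (L-rounded α _) α>-a/b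
  ... | r , -a/b<r , Lr = r , Lr , λ q Lq r≤q →
    subst (+ 0 ℤ.<_) (rearrange a (↧ q) (↥ q) (+ suc k))
      (i<j⇒0<j-i (/<⇒*< (ℤ.- a) k q (ℚP.<-≤-trans -a/b<r r≤q)))
    where
    rearrange : ∀ a d n b → n ℤ.* b ℤ.- (ℤ.- a) ℤ.* d ≡ a ℤ.* d ℤ.+ b ℤ.* n
    rearrange = solve-∀
  pos⇒eventually-value-pos a -[1+ k ] α<a/b with L-inhabited α
  ... | l , Ll = l , Ll , λ q Lq _ →
    subst (+ 0 ℤ.<_) (rearrange a (↧ q) (↥ q) (+ suc k)) (i<j⇒0<j-i (</⇒*< a k q (L<U Lq α<a/b)))
    where
    rearrange : ∀ a d n b → a ℤ.* d ℤ.- n ℤ.* b ≡ a ℤ.* d ℤ.+ (ℤ.- b) ℤ.* n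
    rearrange = solve-∀

  value-neg-pos⇒nonpos : ∀ a b q → + 0 ℤ.< value (ℤ.- a) (ℤ.- b) q → value a b q ℤ.≤ + 0
  value-neg-pos⇒nonpos a b q = 0<-i⇒i≤0 ∘ subst (+ 0 ℤ.<_) (negate a b (↧ q) (↥ q))
    where
    negate : ∀ a b d n → (ℤ.- a) ℤ.* d ℤ.+ (ℤ.- b) ℤ.* n ≡ ℤ.- (a ℤ.* d ℤ.+ b ℤ.* n)
    negate = solve-∀

  pos⊎eventually-value-nonpos : ∀ a b → Pos α a b ⊎ Eventually (λ q → value a b q ℤ.≤ + 0)
  pos⊎eventually-value-nonpos a (+ zero) with + 0 ℤP.<? a
  ... | yes 0<a = inj₁ 0<a
  ... | no  0≮a = inj₂ (always⇒eventually λ q →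
    subst (ℤ._≤ + 0) (sym (value-zero a q)) (ℤP.*-monoʳ-≤-nonNeg (↧ q) (ℤP.≮⇒≥ 0≮a)))
  pos⊎eventually-value-nonpos a +[1+ k ] with irrational ((ℤ.- a) ℚ./ suc k)
  ... | inj₁ α>-a/b = inj₁ α>-a/b
  ... | inj₂ α<-a/b = inj₂ (eventually-map (value-neg-pos⇒nonpos a +[1+ k ])
    (pos⇒eventually-value-pos (ℤ.- a) -[1+ k ] α<-a/b))
  pos⊎eventually-value-nonpos a -[1+ k ] with irrational (a ℚ./ suc k)
  ... | inj₂ α<a/b = inj₁ α<a/b
  ... | inj₁ α>a/b = inj₂ (eventually-map (value-neg-pos⇒nonpos a -[1+ k ])
    (pos⇒eventually-value-pos (ℤ.- a) +[1+ k ]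
      (subst (λ x → L α (x ℚ./ suc k)) (sym (ℤP.neg-involutive a)) α>a/b)))

  -- If (a + c) + (b + d)α > 0 failed, irrationality would make it fail at every rational q just
  -- below α, where also a + bq > 0 and c + dq > 0: absurd.
  pos-+ : ∀ a b c d → Pos α a b → Pos α c d → Pos α (a ℤ.+ c) (b ℤ.+ d)
  pos-+ a b c d a+bα>0 c+dα>0 with pos⊎eventually-value-nonpos (a ℤ.+ c) (b ℤ.+ d)
  ... | inj₁ sum>0 = sum>0
  ... | inj₂ sum≤0
    with eventually-witness (eventually-× (pos⇒eventually-value-pos a b a+bα>0)
                              (eventually-× (pos⇒eventually-value-pos c d c+dα>0) sum≤0))
  ... | q , 0<x , 0<y , x+y≤0 = ⊥-elim (ℤP.<-irrefl refl
        (ℤP.<-≤-trans (ℤP.+-mono-< 0<x 0<y) (subst (ℤ._≤ + 0) (value-+ a b c d (↧ q) (↥ q)) x+y≤0)))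
    where
    value-+ : ∀ a b c d x y →
              (a ℤ.+ c) ℤ.* x ℤ.+ (b ℤ.+ d) ℤ.* y ≡ (a ℤ.* x ℤ.+ b ℤ.* y) ℤ.+ (c ℤ.* x ℤ.+ d ℤ.* y)
    value-+ = solve-∀

  -- Pos α a b computes by cases on b, so a and b cannot be inferred from it.
  data Positive (a b : ℤ) : Set where
    positive : Pos α a b → Positive a b

  infixl 6 _⊕_
  _⊕_ : ∀ {a b c d} → Positive a b → Positive c d → Positive (a ℤ.+ c) (b ℤ.+ d)
  _⊕_ {a} {b} {c} {d} (positive p) (positive q) = positive (pos-+ a b c d p q)

  positive⇒0< : ∀ {a} → Positive a (+ 0) → + 0 ℤ.< a
  positive⇒0< (positive 0<a) = 0<a

  positive-or-negative : ∀ a k → Positive a +[1+ k ] ⊎ Positive (ℤ.- a) -[1+ k ]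
  positive-or-negative a k with irrational ((ℤ.- a) ℚ./ suc k)
  ... | inj₁ α>-a/b = inj₁ (positive α>-a/b)
  ... | inj₂ α<-a/b = inj₂ (positive α<-a/b)

  bounded-below : Σ ℕ λ K → Positive (+ K) (+ 1)
  bounded-below with L-inhabited α
  ... | l , Ll with positive-or-negative (+ ℤ.∣ ↥ l ∣) 0
  ... | inj₁ α>-K = ℤ.∣ ↥ l ∣ , α>-K
  ... | inj₂ (positive α<-K) = ⊥-elim (ℤP.<-irrefl refl
        (ℤP.<-≤-trans (</⇒*< (ℤ.- + ℤ.∣ ↥ l ∣) 0 l (L<U Ll α<-K)) (-∣i∣*n≤i (↥ l) (ℚ.ℚ.denominator-1 l))))

  bounded-above : Σ ℕ λ K → Positive (+ K) -[1+ 0 ]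
  bounded-above with U-inhabited α
  ... | u , Uu with positive-or-negative (ℤ.- + ℤ.∣ ↥ u ∣) 0
  ... | inj₂ α<K = ℤ.∣ ↥ u ∣ , subst (λ a → Positive a -[1+ 0 ]) (ℤP.neg-involutive _) α<K
  ... | inj₁ (positive α>K) = ⊥-elim (ℤP.<-irrefl refl (ℤP.<-≤-trans
        (/<⇒*< (+ ℤ.∣ ↥ u ∣) 0 u (L<U (subst (λ a → L α (a ℚ./ 1)) (ℤP.neg-involutive (+ ℤ.∣ ↥ u ∣)) α>K) Uu))
        (i≤∣i∣*n (↥ u) (ℚ.ℚ.denominator-1 u))))

  multiple-bounded-below : ∀ n → Σ ℕ λ K → Positive (+ K) (+ n)
  multiple-bounded-below zero = 1 , positive (+<+ (s≤s z≤n))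
  multiple-bounded-below (suc n) with bounded-below | multiple-bounded-below n
  ... | K , α>-K | K′ , nα>-K′ = K ℕ.+ K′ , α>-K ⊕ nα>-K′

  multiple-bounded-above : ∀ n → Σ ℕ λ K → Positive (+ K) (ℤ.- + n)
  multiple-bounded-above zero = 1 , positive (+<+ (s≤s z≤n))
  multiple-bounded-above (suc n) with bounded-above | multiple-bounded-above n
  ... | K , α<K | K′ , nα<K′ =
    K ℕ.+ K′ , subst (Positive _) (sym (ℤP.neg-distrib-+ (+ 1) (+ n))) (α<K ⊕ nα<K′)

  floor-search : ∀ k m p → Positive (ℤ.- p) +[1+ k ] → Positive (p ℤ.+ + m) -[1+ k ] →
                 Σ ℤ (IsFloor α (suc k))
  floor-search k zero p nα>p nα<p = ⊥-elim (ℤP.<-irrefl refl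
    (positive⇒0< (subst₂ Positive (cancel p) (ℤP.+-inverseʳ (+ suc k)) (nα>p ⊕ nα<p))))
    where
    cancel : ∀ p → ℤ.- p ℤ.+ (p ℤ.+ + 0) ≡ + 0
    cancel = solve-∀
  floor-search k (suc m) p nα>p nα<p+m with positive-or-negative (ℤ.- (p ℤ.+ + 1)) k
  ... | inj₁ nα>p+1 = floor-search k m (p ℤ.+ + 1) nα>p+1
                        (subst (λ a → Positive a _) (sym (ℤP.+-assoc p (+ 1) (+ m))) nα<p+m)
  ... | inj₂ nα<p+1 with nα>p | subst (λ a → Positive a _) (ℤP.neg-involutive _) nα<p+1
  ... | positive lo | positive hi = p , lo , hi

  floor-exists : ∀ k → Σ ℤ (IsFloor α (suc k))
  floor-exists k with multiple-bounded-below (suc k) | multiple-bounded-above (suc k)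
  ... | K , nα>-K | K′ , nα<K′ =
    floor-search k (K ℕ.+ K′) (ℤ.- + K)
      (subst (λ a → Positive a _) (sym (ℤP.neg-involutive (+ K))) nα>-K)
      (subst (λ a → Positive a _) span nα<K′)
    where
    shift : ∀ x y → y ≡ ℤ.- x ℤ.+ (x ℤ.+ y)
    shift = solve-∀
    span : + K′ ≡ ℤ.- + K ℤ.+ + (K ℕ.+ K′)
    span = trans (shift (+ K) (+ K′)) (cong (λ x → ℤ.- + K ℤ.+ x) (sym (ℤP.pos-+ K K′)))

  floor-unique : ∀ {n p p′} → IsFloor α n p → IsFloor α n p′ → p ≡ p′
  floor-unique {n} (nα>p , nα<p+1) (nα>p′ , nα<p′+1) =
    ℤP.≤-antisym (floor-≤ nα>p nα<p′+1) (floor-≤ nα>p′ nα<p+1)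
    where
    rearrange : ∀ p p′ → ℤ.- p ℤ.+ (p′ ℤ.+ + 1) ≡ p′ ℤ.- p ℤ.+ + 1
    rearrange = solve-∀
    floor-≤ : ∀ {p p′} → Pos α (ℤ.- p) (+ n) → Pos α (p′ ℤ.+ + 1) (ℤ.- + n) → p ℤ.≤ p′
    floor-≤ {p} {p′} nα>p nα<p′+1 = ℤP.0≤i-j⇒j≤i (0<i+1⇒0≤i (positive⇒0<
      (subst₂ Positive (rearrange p p′) (ℤP.+-inverseʳ (+ n))
        (positive {ℤ.- p} {+ n} nα>p ⊕ positive {p′ ℤ.+ + 1} {ℤ.- + n} nα<p′+1))))

  -- junk value at n = 0, where nα is an integer
  ⌊_·α⌋ : ℕ → ℤ
  ⌊ zero ·α⌋  = + 0
  ⌊ suc k ·α⌋ = proj₁ (floor-exists k)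

  floor-isFloor : ∀ {n} → 1 ≤ n → IsFloor α n ⌊ n ·α⌋
  floor-isFloor {suc k} _ = proj₂ (floor-exists k)

  frac>0 : ∀ {n} → 1 ≤ n → Positive (ℤ.- ⌊ n ·α⌋) (+ n)
  frac>0 1≤n = positive (proj₁ (floor-isFloor 1≤n))

  frac<1 : ∀ {n} → 1 ≤ n → Positive (⌊ n ·α⌋ ℤ.+ + 1) (ℤ.- + n)
  frac<1 1≤n = positive (proj₂ (floor-isFloor 1≤n))

  fracLt⇒positive : ∀ {n m} → 1 ≤ n → 1 ≤ m → FracLt α n m →
                    Positive (⌊ n ·α⌋ ℤ.- ⌊ m ·α⌋) (+ m ℤ.- + n)
  fracLt⇒positive {n} {m} 1≤n 1≤m (p , q , p-floor , q-floor , lt) =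
    subst₂ (λ p q → Positive (p ℤ.- q) (+ m ℤ.- + n))
      (floor-unique {n} p-floor (floor-isFloor 1≤n)) (floor-unique {m} q-floor (floor-isFloor 1≤m))
      (positive lt)

  positive⇒fracLt : ∀ {n m} → 1 ≤ n → 1 ≤ m →
                    Positive (⌊ n ·α⌋ ℤ.- ⌊ m ·α⌋) (+ m ℤ.- + n) → FracLt α n m
  positive⇒fracLt 1≤n 1≤m (positive lt) = _ , _ , floor-isFloor 1≤n , floor-isFloor 1≤m , lt

module Reflection (α : ℝ) (irrational : Irrational α) (N : ℕ) where
  open LinearForms α irrational

  mirror : ℕ → ℕ
  mirror n = N + 1 ∸ n

  InRange : ℕ → Set
  InRange n = 1 ≤ n × n ≤ N

  n<N+1 : ∀ {n} → n ≤ N → n ℕ.< N + 1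
  n<N+1 {n} n≤N = subst (n ℕ.<_) (ℕP.+-comm 1 N) (s≤s n≤N)

  mirror-inRange : ∀ {n} → InRange n → InRange (mirror n)
  mirror-inRange {n} (1≤n , n≤N) =
    ℕP.m<n⇒0<n∸m (n<N+1 n≤N) , subst (mirror n ≤_) (ℕP.m+n∸n≡m N 1) (ℕP.∸-monoʳ-≤ (N + 1) 1≤n)

  mirror-involutive : ∀ {n} → InRange n → mirror (mirror n) ≡ n
  mirror-involutive (_ , n≤N) = ℕP.m∸[m∸n]≡n (ℕP.<⇒≤ (n<N+1 n≤N))

  M : ℤ
  M = + (N + 1)

  +mirror : ∀ {n} → InRange n → + mirror n ≡ M ℤ.- + n
  +mirror {n} (_ , n≤N) = sym (trans (ℤP.m-n≡m⊖n (N + 1) n) (ℤP.⊖-≥ (ℕP.<⇒≤ (n<N+1 n≤N))))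

  mirror-frac>0 : ∀ {n} → InRange n → Positive (ℤ.- ⌊ mirror n ·α⌋) (M ℤ.- + n)
  mirror-frac>0 r = subst (Positive _) (+mirror r) (frac>0 (proj₁ (mirror-inRange r)))

  mirror-frac<1 : ∀ {n} → InRange n → Positive (⌊ mirror n ·α⌋ ℤ.+ + 1) (ℤ.- (M ℤ.- + n))
  mirror-frac<1 {n} r =
    subst (λ b → Positive (⌊ mirror n ·α⌋ ℤ.+ + 1) (ℤ.- b)) (+mirror r) (frac<1 (proj₁ (mirror-inRange r)))

  mirror-fracLt⇒positive : ∀ {a b} → InRange a → InRange b → FracLt α (mirror a) (mirror b) →
                           Positive (⌊ mirror a ·α⌋ ℤ.- ⌊ mirror b ·α⌋) (+ a ℤ.- + b)
  mirror-fracLt⇒positive {a} {b} ra rb lt =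
    subst (Positive _) (trans (cong₂ ℤ._-_ (+mirror rb) (+mirror ra)) (cancel M (+ a) (+ b)))
      (fracLt⇒positive (proj₁ (mirror-inRange ra)) (proj₁ (mirror-inRange rb)) lt)
    where
    cancel : ∀ m a b → (m ℤ.- b) ℤ.- (m ℤ.- a) ≡ a ℤ.- b
    cancel = solve-∀

  -- ⌊(N+1-n)α⌋ + ⌊nα⌋ is ⌊(N+1)α⌋ or ⌊(N+1)α⌋ - 1 according as {nα} lies below or above {(N+1)α}.
  floorSum : ℕ → ℤ
  floorSum n = ⌊ mirror n ·α⌋ ℤ.+ ⌊ n ·α⌋

  floorSum-antitone : ∀ {a b} → InRange a → InRange b → FracLt α (mirror a) (mirror b) →
                      floorSum b ℤ.≤ floorSum a
  floorSum-antitone {a} {b} ra rb lt = ℤP.0≤i-j⇒j≤i (0<i+1⇒0≤i (positive⇒0<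
    (subst₂ Positive (collect ⌊ mirror a ·α⌋ ⌊ mirror b ·α⌋ ⌊ a ·α⌋ ⌊ b ·α⌋) (cancel (+ a) (+ b))
      (mirror-fracLt⇒positive ra rb lt ⊕ frac>0 (proj₁ rb) ⊕ frac<1 (proj₁ ra)))))
    where
    collect : ∀ A B a b → A ℤ.- B ℤ.+ ℤ.- b ℤ.+ (a ℤ.+ + 1) ≡ (A ℤ.+ a) ℤ.- (B ℤ.+ b) ℤ.+ + 1
    collect = solve-∀
    cancel : ∀ a b → a ℤ.- b ℤ.+ b ℤ.+ ℤ.- a ≡ + 0
    cancel = solve-∀

  floorSum-spread : ∀ {a c} → InRange a → InRange c → floorSum a ℤ.≤ ℤ.suc (floorSum c)
  floorSum-spread {a} {c} ra rc = ℤP.0≤i-j⇒j≤i (0<i+1⇒0≤i (positive⇒0<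
    (subst₂ Positive (collect ⌊ mirror a ·α⌋ ⌊ mirror c ·α⌋ ⌊ a ·α⌋ ⌊ c ·α⌋) (cancel M (+ a) (+ c))
      (mirror-frac>0 ra ⊕ mirror-frac<1 rc ⊕ frac>0 (proj₁ ra) ⊕ frac<1 (proj₁ rc)))))
    where
    collect : ∀ A C a c → ℤ.- A ℤ.+ (C ℤ.+ + 1) ℤ.+ ℤ.- a ℤ.+ (c ℤ.+ + 1)
                          ≡ (+ 1 ℤ.+ (C ℤ.+ c)) ℤ.- (A ℤ.+ a) ℤ.+ + 1
    collect = solve-∀
    cancel : ∀ m a c → (m ℤ.- a) ℤ.+ ℤ.- (m ℤ.- c) ℤ.+ a ℤ.+ ℤ.- c ≡ + 0
    cancel = solve-∀

  fracLt-of-equal-floorSum : ∀ {a b} → InRange a → InRange b → FracLt α (mirror a) (mirror b) →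
                             floorSum a ≡ floorSum b → FracLt α b a
  fracLt-of-equal-floorSum {a} {b} ra rb lt same =
    positive⇒fracLt (proj₁ rb) (proj₁ ra)
      (subst (λ x → Positive x (+ a ℤ.- + b)) floors (mirror-fracLt⇒positive ra rb lt))
    where
    split : ∀ A B a b → A ℤ.- B ≡ ((A ℤ.+ a) ℤ.- (B ℤ.+ b)) ℤ.+ (b ℤ.- a)
    split = solve-∀
    floors : ⌊ mirror a ·α⌋ ℤ.- ⌊ mirror b ·α⌋ ≡ ⌊ b ·α⌋ ℤ.- ⌊ a ·α⌋
    floors = begin
      ⌊ mirror a ·α⌋ ℤ.- ⌊ mirror b ·α⌋
        ≡⟨ split ⌊ mirror a ·α⌋ ⌊ mirror b ·α⌋ ⌊ a ·α⌋ ⌊ b ·α⌋ ⟩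
      (floorSum a ℤ.- floorSum b) ℤ.+ (⌊ b ·α⌋ ℤ.- ⌊ a ·α⌋)
        ≡⟨ cong (ℤ._+ _) (ℤP.i≡j⇒i-j≡0 same) ⟩
      + 0 ℤ.+ (⌊ b ·α⌋ ℤ.- ⌊ a ·α⌋)
        ≡⟨ ℤP.+-identityˡ _ ⟩
      ⌊ b ·α⌋ ℤ.- ⌊ a ·α⌋
        ∎
      where open ≡-Reasoning

  fracLt-of-floorSum-step : ∀ {a c} → InRange a → InRange c → floorSum a ≡ ℤ.suc (floorSum c) →
                            FracLt α a c
  fracLt-of-floorSum-step {a} {c} ra rc step =
    positive⇒fracLt (proj₁ ra) (proj₁ rc) (subst₂ Positive floors (cancel M (+ a) (+ c))
      (mirror-frac>0 ra ⊕ mirror-frac<1 rc))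
    where
    split : ∀ A C a c → ℤ.- A ℤ.+ (C ℤ.+ + 1) ≡ ((+ 1 ℤ.+ (C ℤ.+ c)) ℤ.- (A ℤ.+ a)) ℤ.+ (a ℤ.- c)
    split = solve-∀
    cancel : ∀ m a c → (m ℤ.- a) ℤ.+ ℤ.- (m ℤ.- c) ≡ c ℤ.- a
    cancel = solve-∀
    floors : ℤ.- ⌊ mirror a ·α⌋ ℤ.+ (⌊ mirror c ·α⌋ ℤ.+ + 1) ≡ ⌊ a ·α⌋ ℤ.- ⌊ c ·α⌋
    floors = begin
      ℤ.- ⌊ mirror a ·α⌋ ℤ.+ (⌊ mirror c ·α⌋ ℤ.+ + 1)
        ≡⟨ split ⌊ mirror a ·α⌋ ⌊ mirror c ·α⌋ ⌊ a ·α⌋ ⌊ c ·α⌋ ⟩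
      (ℤ.suc (floorSum c) ℤ.- floorSum a) ℤ.+ (⌊ a ·α⌋ ℤ.- ⌊ c ·α⌋)
        ≡⟨ cong (ℤ._+ _) (ℤP.i≡j⇒i-j≡0 (sym step)) ⟩
      + 0 ℤ.+ (⌊ a ·α⌋ ℤ.- ⌊ c ·α⌋)
        ≡⟨ ℤP.+-identityˡ _ ⟩
      ⌊ a ·α⌋ ℤ.- ⌊ c ·α⌋
        ∎
      where open ≡-Reasoning

  mirror-fracLt-chain : ∀ {a b c} → InRange a → InRange b → InRange c →
                        FracLt α (mirror a) (mirror b) → FracLt α (mirror b) (mirror c) → CycBetween α c b a
  mirror-fracLt-chain ra rb rc A<B B<C
    with squeeze (floorSum-antitone rb rc B<C) (floorSum-antitone ra rb A<B) (floorSum-spread ra rc)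
  ... | inj₁ (a≈b , b≈c) =
    inj₁ (fracLt-of-equal-floorSum rb rc B<C b≈c , fracLt-of-equal-floorSum ra rb A<B a≈b)
  ... | inj₂ (a≈c+1 , inj₁ a≈b) =
    inj₂ (inj₁ (fracLt-of-equal-floorSum ra rb A<B a≈b , fracLt-of-floorSum-step ra rc a≈c+1))
  ... | inj₂ (a≈c+1 , inj₂ b≈c) =
    inj₂ (inj₂ (fracLt-of-floorSum-step ra rc a≈c+1 , fracLt-of-equal-floorSum rb rc B<C b≈c))

  mirror-cycBetween : ∀ {a b c} → InRange a → InRange b → InRange c →
                      CycBetween α (mirror a) (mirror b) (mirror c) → CycBetween α c b a
  mirror-cycBetween ra rb rc (inj₁ (A<B , B<C))        = mirror-fracLt-chain ra rb rc A<B B<C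
  mirror-cycBetween {a} {b} {c} ra rb rc (inj₂ (inj₁ (B<C , C<A))) =
    cycBetween-rotate α a c b (mirror-fracLt-chain rb rc ra B<C C<A)
  mirror-cycBetween {a} {b} {c} ra rb rc (inj₂ (inj₂ (C<A , A<B))) =
    cycBetween-rotate α a c b (cycBetween-rotate α b a c (mirror-fracLt-chain rc ra rb C<A A<B))

  Adjacent : ℕ → ℕ → Set
  Adjacent x y = ∀ c → 1 ≤ c → c ≤ N → ¬ CycBetween α x c y

  mirror-adjacent : ∀ {x y} → InRange x → InRange y → Adjacent x y → Adjacent (mirror y) (mirror x)
  mirror-adjacent {x} {y} rx ry adj c 1≤c c≤N between =
    adj (mirror c) (proj₁ rc′) (proj₂ rc′) (mirror-cycBetween ry rc′ rx
      (subst (λ z → CycBetween α (mirror y) z (mirror x)) (sym (mirror-involutive (1≤c , c≤N))) between))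
    where
    rc′ : InRange (mirror c)
    rc′ = mirror-inRange (1≤c , c≤N)

  adjacentChain⇒linked : ∀ {xs} → AdjacentChain α N xs → Linked Adjacent xs
  adjacentChain⇒linked {[]}         _            = []
  adjacentChain⇒linked {_ ∷ []}     _            = [-]
  adjacentChain⇒linked {_ ∷ _ ∷ _}  (adj , rest) = adj ∷ adjacentChain⇒linked rest

  linked⇒adjacentChain : ∀ {xs} → Linked Adjacent xs → AdjacentChain α N xs
  linked⇒adjacentChain []          = tt
  linked⇒adjacentChain [-]         = tt
  linked⇒adjacentChain (adj ∷ rest) = adj , linked⇒adjacentChain rest

  mirror-reverse-consecutive : ∀ {xs} → Consecutive α N xs → Consecutive α N (map mirror (reverse xs))
  mirror-reverse-consecutive {xs} (inRange , unique , chain) =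
    All.map⁺ (All.map mirror-inRange inRange′) ,
    Unique.map⁻ (subst Unique (sym mirror²) (Unique-reverse unique)) ,
    linked⇒adjacentChain (Linked.map⁺ (Linked-reverse
      (Linked-map-local mirror-adjacent inRange (adjacentChain⇒linked chain))))
    where
    inRange′ : All InRange (reverse xs)
    inRange′ = All-resp-↭ (↭-sym (↭-reverse xs)) inRange
    mirror² : map mirror (map mirror (reverse xs)) ≡ reverse xs
    mirror² = trans (sym (List.map-∘ (reverse xs))) (List.map-id-local (All.map mirror-involutive inRange′))

corollary3p2 : (α : ℝ) → Irrational α → (N : ℕ) → 1 ≤ N →
    (Ls Rs : List ℕ) →
    Consecutive α N (Ls ++ (1 ∷ Rs)) →
    Consecutive α N (map (λ r → N + 1 ∸ r) (reverse Rs) ++ (N ∷ map (λ l → N + 1 ∸ l) (reverse Ls)))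
corollary3p2 α irrational N _ Ls Rs consecutive =
  subst (Consecutive α N) reflected (mirror-reverse-consecutive consecutive)
  where
  open Reflection α irrational N
  reflected : map mirror (reverse (Ls ++ 1 ∷ Rs)) ≡ map mirror (reverse Rs) ++ N ∷ map mirror (reverse Ls)
  reflected = trans (map-reverse-++-∷ mirror Ls 1 Rs)
    (cong (λ x → map mirror (reverse Rs) ++ x ∷ map mirror (reverse Ls)) (ℕP.m+n∸n≡m N 1))
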